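{- Let $t\ge 2$ and let $A$ be a packing array PA$(n;t,k,v)$. If $w$ is a positive integer with $w\leq \frac{k-1}{t-1}$, then the transpose $A^T$ is a separating hash family SHF$(N=k;\, n,\, m=v,\, \{1,w\})$.
   Context: A packing array PA$(n;t,k,v)$ is an $n\times k$ array with entries from an alphabet of $v$ symbols such that in any $t$ columns, every $t$-tuple of symbols occurs in at most one row. An SHF$(N;n,m,\{1,w\})$ (separating hash family of type $\{1,w\}$) can be viewed as an $N\times n$ array with entries from an $m$-symbol alphabet such that for every column $c_0$ and every set $C$ of $w$ columns not containing $c_0$, there is a row $r$ with $A(r,c_0)\neq A(r,c)$ for all $c\in C$ (equivalently, a set $\mathcal F$ of $N$ functions from an $n$-set to an $m$-set such that for any disjoint sets $C_1,C_2$ with $|C_1|=1$, $|C_2|=w$, some $f\in\mathcal F$ satisfies $f(C_1)\cap f(C_2)=\emptyset$). -}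

module Defs where

open import Data.Nat using (ℕ)
open import Data.Fin using (Fin)
open import Data.Product using (∃-syntax)
open import Function.Definitions using (Injective)
open import Relation.Binary.PropositionalEquality using (_≡_; _≢_)

Array : ℕ → ℕ → ℕ → Set
Array r c s = Fin r → Fin c → Fin s

transpose : ∀ {r c s} → Array r c s → Array c r s
transpose A j i = A i j

-- PA(n;t,k,v): an n×k array over v symbols such that for any t distinct
-- columns, every t-tuple of symbols occurs in at most one row, i.e. two rows
-- agreeing on those t columns are the same row.
IsPackingArray : (n t k v : ℕ) → Array n k v → Set
IsPackingArray n t k v A =
  (cols : Fin t → Fin k) → Injective _≡_ _≡_ cols →
  (r₁ r₂ : Fin n) → (∀ i → A r₁ (cols i) ≡ A r₂ (cols i)) → r₁ ≡ r₂

-- SHF(N;n,m,{1,w}): an N×n array over m symbols such that for every column c₀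
-- and every set C of w columns not containing c₀ (given as an injective
-- enumeration Fin w → Fin n avoiding c₀), some row separates c₀ from C.
IsSHF1w : (N n m w : ℕ) → Array N n m → Set
IsSHF1w N n m w B =
  (c₀ : Fin n) (C : Fin w → Fin n) → Injective _≡_ _≡_ C → (∀ i → C i ≢ c₀) →
  ∃[ r ] (∀ i → B r c₀ ≢ B r (C i))

-- Two distinct rows of a packing array of strength t agree in at most t − 1 columns,
-- since t agreeing columns would make them the same row. Given a row c₀ and w other
-- rows, the columns where c₀ agrees with at least one of them therefore number at most
-- w(t − 1) ≤ k − 1 < k, so some column of A agrees with none of them: in Aᵀ that
-- column is a row separating c₀ from the w others.
module Submission where

open import Defs
open import Data.Bool using (true)
open import Data.Fin using (Fin; zero; suc; inject≤; _≟_)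
open import Data.Fin.Properties using (suc-injective; inject≤-injective)
open import Data.Fin.Subset
  using (Subset; inside; outside; _∈_; _∉_; _⊆_; _∪_; ∁; ⋃; ⊥; ∣_∣)
open import Data.Fin.Subset.Properties
  using (p⊆p∪q; q⊆p∪q; ∣⊥∣≡0; ∣∁p∣≡n∸∣p∣; nonempty?; Empty-unique; x∈∁p⇒x∉p)
open import Data.List as List using (List; []; _∷_; length)
open import Data.List.Membership.Propositional using () renaming (_∈_ to _∈ₗ_)
open import Data.List.Membership.Propositional.Properties using (∈-tabulate⁺)
open import Data.List.Properties using (length-tabulate)
open import Data.List.Relation.Unary.All using (All; []; _∷_)
open import Data.List.Relation.Unary.All.Properties using (tabulate⁺)
open import Data.List.Relation.Unary.Any using (here; there)
open import Data.Nat using (ℕ; _≤_; _<_; _+_; _*_; _∸_; z≤n; s≤s; _≤?_; >-nonZero)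
open import Data.Nat.Properties
  using (≤-trans; ≤-reflexive; +-suc; n≤1+n; +-monoʳ-≤; +-mono-≤; *-mono-≤; <⇒≢; ≰⇒>;
         m<n⇒0<n∸m; <⇒≤pred; ≤pred⇒≤; pred-mono-≤; m≤pred[n]⇒suc[m]≤n; <-≤-trans; ≤-<-trans)
open import Data.Product using (∃-syntax; _,_)
open import Data.Vec using ([]; _∷_; tabulate)
open import Data.Vec.Base using (here; there)
open import Data.Vec.Properties using (lookup∘tabulate; []=⇒lookup; lookup⇒[]=)
open import Function.Definitions using (Injective)
open import Relation.Binary.PropositionalEquality
  using (_≡_; _≢_; refl; sym; trans; cong; subst; ≢-sym; module ≡-Reasoning)
open import Relation.Nullary using (yes; no; does; proof; contradiction)
open import Relation.Nullary.Reflects using (Reflects; invert)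
open import Relation.Nullary.Decidable using (dec-true)

private
  variable
    n k v : ℕ

∣p∪q∣≤∣p∣+∣q∣ : ∀ (p q : Subset n) → ∣ p ∪ q ∣ ≤ ∣ p ∣ + ∣ q ∣
∣p∪q∣≤∣p∣+∣q∣ []            []            = z≤n
∣p∪q∣≤∣p∣+∣q∣ (outside ∷ p) (outside ∷ q) = ∣p∪q∣≤∣p∣+∣q∣ p q
∣p∪q∣≤∣p∣+∣q∣ (outside ∷ p) (inside  ∷ q) =
  ≤-trans (s≤s (∣p∪q∣≤∣p∣+∣q∣ p q)) (≤-reflexive (sym (+-suc ∣ p ∣ ∣ q ∣)))
∣p∪q∣≤∣p∣+∣q∣ (inside  ∷ p) (outside ∷ q) = s≤s (∣p∪q∣≤∣p∣+∣q∣ p q)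
∣p∪q∣≤∣p∣+∣q∣ (inside  ∷ p) (inside  ∷ q) =
  s≤s (≤-trans (∣p∪q∣≤∣p∣+∣q∣ p q) (+-monoʳ-≤ ∣ p ∣ (n≤1+n ∣ q ∣)))

∣⋃ps∣≤length*b : ∀ {b} (ps : List (Subset n)) → All (λ p → ∣ p ∣ ≤ b) ps →
                 ∣ ⋃ ps ∣ ≤ length ps * b
∣⋃ps∣≤length*b {n} []       []           = ≤-reflexive (∣⊥∣≡0 n)
∣⋃ps∣≤length*b     (p ∷ ps) (p≤b ∷ ps≤b) =
  ≤-trans (∣p∪q∣≤∣p∣+∣q∣ p (⋃ ps)) (+-mono-≤ p≤b (∣⋃ps∣≤length*b ps ps≤b))

p∈ps⇒p⊆⋃ps : ∀ {p} {ps : List (Subset n)} → p ∈ₗ ps → p ⊆ ⋃ ps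
p∈ps⇒p⊆⋃ps {ps = _ ∷ ps} (here refl) = p⊆p∪q (⋃ ps)
p∈ps⇒p⊆⋃ps {ps = q ∷ ps} (there p∈ps) x∈p = q⊆p∪q q (⋃ ps) (p∈ps⇒p⊆⋃ps p∈ps x∈p)

∣p∣<n⇒∃∉p : ∀ (p : Subset n) → ∣ p ∣ < n → ∃[ x ] x ∉ p
∣p∣<n⇒∃∉p {n} p ∣p∣<n with nonempty? (∁ p)
... | yes (x , x∈∁p) = x , x∈∁p⇒x∉p x∈∁p
... | no  ∁p-empty   = contradiction n∸∣p∣≡0 (≢-sym (<⇒≢ (m<n⇒0<n∸m ∣p∣<n)))
  where
  n∸∣p∣≡0 : n ∸ ∣ p ∣ ≡ 0
  n∸∣p∣≡0 = begin
    n ∸ ∣ p ∣  ≡⟨ ∣∁p∣≡n∸∣p∣ p ⟨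
    ∣ ∁ p ∣    ≡⟨ cong ∣_∣ (Empty-unique ∁p-empty) ⟩
    ∣ ⊥ {n} ∣  ≡⟨ ∣⊥∣≡0 n ⟩
    0          ∎
    where open ≡-Reasoning

enumerate : (p : Subset n) → Fin ∣ p ∣ → Fin n
enumerate (outside ∷ p) i       = suc (enumerate p i)
enumerate (inside  ∷ p) zero    = zero
enumerate (inside  ∷ p) (suc i) = suc (enumerate p i)

enumerate-injective : ∀ (p : Subset n) → Injective _≡_ _≡_ (enumerate p)
enumerate-injective (outside ∷ p)                 eq = enumerate-injective p (suc-injective eq)
enumerate-injective (inside  ∷ p) {zero}  {zero}  eq = refl
enumerate-injective (inside  ∷ p) {suc i} {suc j} eq =
  cong suc (enumerate-injective p (suc-injective eq))

enumerate-∈ : ∀ (p : Subset n) i → enumerate p i ∈ p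
enumerate-∈ (outside ∷ p) i       = there (enumerate-∈ p i)
enumerate-∈ (inside  ∷ p) zero    = here
enumerate-∈ (inside  ∷ p) (suc i) = there (enumerate-∈ p i)

agreement : Array n k v → Fin n → Fin n → Subset k
agreement A r₁ r₂ = tabulate λ j → does (A r₁ j ≟ A r₂ j)

module _ (A : Array n k v) {r₁ r₂ : Fin n} {j : Fin k} where

  ∈-agreement⁻ : j ∈ agreement A r₁ r₂ → A r₁ j ≡ A r₂ j
  ∈-agreement⁻ j∈S = invert (subst (Reflects _) does≡true (proof (A r₁ j ≟ A r₂ j)))
    where
    does≡true : does (A r₁ j ≟ A r₂ j) ≡ true
    does≡true = trans (sym (lookup∘tabulate _ j)) ([]=⇒lookup j∈S)

  ∈-agreement⁺ : A r₁ j ≡ A r₂ j → j ∈ agreement A r₁ r₂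
  ∈-agreement⁺ eq =
    lookup⇒[]= j _ (trans (lookup∘tabulate _ j) (dec-true (A r₁ j ≟ A r₂ j) eq))

∣agreement∣<t : ∀ {t} (A : Array n k v) → IsPackingArray n t k v A →
                ∀ {r₁ r₂} → r₁ ≢ r₂ → ∣ agreement A r₁ r₂ ∣ < t
∣agreement∣<t {k = k} {t = t} A pa {r₁} {r₂} r₁≢r₂ with t ≤? ∣ agreement A r₁ r₂ ∣
... | no  t≰∣S∣ = ≰⇒> t≰∣S∣
... | yes t≤∣S∣ = contradiction (pa cols cols-injective r₁ r₂ agree-on-cols) r₁≢r₂
  where
  S : Subset k
  S = agreement A r₁ r₂

  cols : Fin t → Fin k
  cols i = enumerate S (inject≤ i t≤∣S∣)

  cols-injective : Injective _≡_ _≡_ cols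
  cols-injective eq = inject≤-injective t≤∣S∣ t≤∣S∣ _ _ (enumerate-injective S eq)

  agree-on-cols : ∀ i → A r₁ (cols i) ≡ A r₂ (cols i)
  agree-on-cols i = ∈-agreement⁻ A (enumerate-∈ S (inject≤ i t≤∣S∣))

proposition1 : (n t k v w : ℕ) → 2 ≤ t → (A : Array n k v) →
    IsPackingArray n t k v A → 1 ≤ w → w * (t ∸ 1) ≤ k ∸ 1 →
    IsSHF1w k n v w (transpose A)
-- The columns of C need not be distinct for this argument.
proposition1 n t k v w 2≤t A pa 1≤w w[t∸1]≤k∸1 c₀ C _ C≢c₀
  with ∣p∣<n⇒∃∉p (⋃ agreements) (≤-<-trans ∣⋃agreements∣≤w[t∸1] w[t∸1]<k)
  where
  agreements : List (Subset k)
  agreements = List.tabulate λ i → agreement A c₀ (C i)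

  ∣⋃agreements∣≤w[t∸1] : ∣ ⋃ agreements ∣ ≤ w * (t ∸ 1)
  ∣⋃agreements∣≤w[t∸1] = subst (λ l → ∣ ⋃ agreements ∣ ≤ l * (t ∸ 1))
    (length-tabulate λ i → agreement A c₀ (C i))
    (∣⋃ps∣≤length*b agreements
      (tabulate⁺ λ i → <⇒≤pred (∣agreement∣<t A pa (≢-sym (C≢c₀ i)))))

  0<w[t∸1] : 0 < w * (t ∸ 1)
  0<w[t∸1] = *-mono-≤ 1≤w (pred-mono-≤ 2≤t)

  w[t∸1]<k : w * (t ∸ 1) < k
  w[t∸1]<k = m≤pred[n]⇒suc[m]≤n
    {{>-nonZero (<-≤-trans 0<w[t∸1] (≤pred⇒≤ w[t∸1]≤k∸1))}} w[t∸1]≤k∸1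
... | j , j∉⋃agreements =
  j , λ i eq → j∉⋃agreements (p∈ps⇒p⊆⋃ps (∈-tabulate⁺ i) (∈-agreement⁺ A eq))
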